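{- Let $G$ be a graph, $\mathcal{P}=(X_1,\ldots,X_l)$ a path decomposition of $G$, $S\subseteq V(G)$, $x\in S$, and $H$ an $S$-branch. Then: (i) if $\alpha(x)\leq\alpha(H)$, then $x\in X_i$ for all $\alpha(x)\leq i\leq\alpha(H)$; (ii) $\alpha(x)\leq\beta(H)$; (iii) if $\beta(x)\geq\beta(H)$, then $x\in X_i$ for all $\beta(H)\leq i\leq\beta(x)$; (iv) $\alpha(H)\leq\beta(x)$.
   Context: A path decomposition of $G$ is a sequence $(X_1,\ldots,X_l)$ of subsets of $V(G)$ with $\bigcup_iX_i=V(G)$, every edge inside some $X_i$, and $X_i\cap X_k\subseteq X_j$ for $i\leq j\leq k$. For a subgraph $H$ of $G$, $\alpha(H)=\min\{i: X_i\cap V(H)\neq\emptyset\}$ and $\beta(H)=\max\{i:X_i\cap V(H)\neq\emptyset\}$; for a vertex $v$, $\alpha(v)=\alpha(G[\{v\}])$, $\beta(v)=\beta(G[\{v\}])$. For $S\subseteq V(G)$, an $S$-component is a connected component $H$ of $G-S$ with $N_G(V(H))=S$ (every vertex of $S$ has a neighbour in $V(H)$, and all neighbours of $V(H)$ outside $V(H)$ lie in $S$); an $S$-branch is an $S$-component with at least two vertices. -}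

module Defs where

open import Data.Nat using (ℕ)
open import Data.Fin using (Fin; _≤_)
open import Data.Fin.Subset using (Subset; _∈_; _∉_)
open import Data.Product using (Σ; ∃; _×_; _,_)
open import Relation.Binary.PropositionalEquality using (_≡_)
open import Relation.Nullary using (¬_)

record Graph : Set₁ where
  field
    n      : ℕ
    Adj    : Fin n → Fin n → Set
    sym    : ∀ {u v} → Adj u v → Adj v u
    irrefl : ∀ {u} → ¬ Adj u u

module _ (G : Graph) where
  open Graph G

  Vertex : Set
  Vertex = Fin n

  -- A path decomposition (X_1,…,X_l), indexed here by Fin l (0-based).
  record PathDecomposition (l : ℕ) : Set where
    field
      bag    : Fin l → Subset n
      covers : ∀ v → ∃ λ i → v ∈ bag i
      edges  : ∀ u v → Adj u v → ∃ λ i → u ∈ bag i × v ∈ bag i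
      interp : ∀ i j k → i ≤ j → j ≤ k → ∀ v → v ∈ bag i → v ∈ bag k → v ∈ bag j

  data ReachIn (C : Subset n) : Vertex → Vertex → Set where
    here : ∀ {u} → u ∈ C → ReachIn C u u
    step : ∀ {u w v} → u ∈ C → Adj u w → ReachIn C w v → ReachIn C u v

  IsComponentOf-G-minus : Subset n → Subset n → Set
  IsComponentOf-G-minus S C =
    (∃ λ v → v ∈ C)
    × (∀ v → v ∈ C → v ∉ S)
    × (∀ u v → u ∈ C → v ∈ C → ReachIn C u v)
    × (∀ u w → u ∈ C → Adj u w → w ∉ S → w ∈ C)

  InNeighbourhood : Subset n → Vertex → Set
  InNeighbourhood C w = w ∉ C × ∃ λ u → u ∈ C × Adj u w

  IsSComponent : Subset n → Subset n → Set
  IsSComponent S C =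
    IsComponentOf-G-minus S C
    × (∀ w → InNeighbourhood C w → w ∈ S)
    × (∀ w → w ∈ S → InNeighbourhood C w)

  IsSBranch : Subset n → Subset n → Set
  IsSBranch S C = IsSComponent S C × (∃ λ u → ∃ λ v → u ∈ C × v ∈ C × ¬ u ≡ v)

  module _ {l : ℕ} (P : PathDecomposition l) where
    open PathDecomposition P

    Meets : Subset n → Fin l → Set
    Meets C i = ∃ λ v → v ∈ C × v ∈ bag i

    IsFirst : (Fin l → Set) → Fin l → Set
    IsFirst Q a = Q a × (∀ j → Q j → a ≤ j)

    IsLast : (Fin l → Set) → Fin l → Set
    IsLast Q b = Q b × (∀ j → Q j → j ≤ b)

    IsAlpha IsBeta : Subset n → Fin l → Set
    IsAlpha C = IsFirst (Meets C)
    IsBeta  C = IsLast (Meets C)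

    IsAlphaV IsBetaV : Vertex → Fin l → Set
    IsAlphaV x = IsFirst (λ i → x ∈ bag i)
    IsBetaV  x = IsLast (λ i → x ∈ bag i)

-- Since N(V(H)) = S, the vertex x has a neighbour u in H, and the edge ux lies in
-- some bag X_j.  That bag contains x and meets H, so α(x), α(H) ≤ j ≤ β(x), β(H);
-- all four claims follow, (i) and (iii) by the interpolation property between j and
-- α(x) resp. β(x).
module Submission where

open import Defs
open import Data.Nat using (ℕ)
open import Data.Fin using (Fin; _≤_)
open import Data.Fin.Properties using (≤-trans)
open import Data.Fin.Subset using (Subset; _∈_)
open import Data.Product using (∃; _×_; _,_; proj₁; proj₂)

module _ (G : Graph) {l : ℕ} (P : PathDecomposition G l) where
  open Graph G using (n)
  open PathDecomposition P

  separator-vertex-shares-bag-with-component :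
    ∀ {S H : Subset n} {x} → IsSComponent G S H → x ∈ S
    → ∃ λ j → x ∈ bag j × Meets G P H j
  separator-vertex-shares-bag-with-component (_ , _ , S⊆N[H]) x∈S
    with S⊆N[H] _ x∈S
  ... | _ , u , u∈H , u~x with edges u _ u~x
  ... | j , u∈j , x∈j = j , x∈j , u , u∈H , u∈j

lemma14 : (G : Graph) → (l : ℕ) → (P : PathDecomposition G l)
    → (S : Subset (Graph.n G)) → (x : Fin (Graph.n G)) → x ∈ S
    → (H : Subset (Graph.n G)) → IsSBranch G S H
    → (ax bx aH bH : Fin l)
    → IsAlphaV G P x ax → IsBetaV G P x bx
    → IsAlpha G P H aH → IsBeta G P H bH
    → ((ax ≤ aH → ∀ i → ax ≤ i → i ≤ aH → x ∈ PathDecomposition.bag P i)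
    × ax ≤ bH
    × (bH ≤ bx → ∀ i → bH ≤ i → i ≤ bx → x ∈ PathDecomposition.bag P i)
    × aH ≤ bx)
lemma14 G l P S x x∈S H (H-comp , _) ax bx aH bH
        (x∈ax , ax-least) (x∈bx , bx-greatest) (_ , aH-least) (_ , bH-greatest) =
    (λ _ i ax≤i i≤aH → interp ax i j ax≤i (≤-trans i≤aH aH≤j) x x∈ax x∈j)
  , ≤-trans ax≤j j≤bH
  , (λ _ i bH≤i i≤bx → interp j i bx (≤-trans j≤bH bH≤i) i≤bx x x∈j x∈bx)
  , ≤-trans aH≤j j≤bx
  where
  open PathDecomposition P
  shared : ∃ λ j → x ∈ bag j × Meets G P H j
  shared = separator-vertex-shares-bag-with-component G P H-comp x∈S
  j = proj₁ shared
  x∈j = proj₁ (proj₂ shared)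
  H∩j = proj₂ (proj₂ shared)
  ax≤j = ax-least j x∈j
  j≤bx = bx-greatest j x∈j
  aH≤j = aH-least j H∩j
  j≤bH = bH-greatest j H∩j
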